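{- For every integer $w \ge 1$ there exists a two-dimensional poset $R_w$ of width $w$ with realizers $L_1, L_2$ such that the cover graph of $R_w$ with vertex order $L_1$ contains a $\big(w(w+1)/2\big)$-rainbow.
   Context: A poset $P=(X,<)$ is a finite set with a transitive, asymmetric relation; its width is the maximum number of pairwise incomparable elements. A cover relation $a\prec b$ means $a<b$ with no $c$ satisfying $a<c<b$; the cover graph has vertex set $X$ and an edge $\{a,b\}$ for each cover relation. A linear extension is a total order $L$ of $X$ with $a<_L b$ whenever $a<_P b$. $P$ is two-dimensional with realizers $L_1,L_2$ if $L_1,L_2$ are linear extensions such that $a<b$ in $P$ iff $a<b$ in both. Given a vertex order $\sigma$, a $k$-rainbow is a set of edges $\{(u_i,v_i): i=1,\dots,k\}$ with $u_1<_\sigma u_2<_\sigma\dots<_\sigma u_k<_\sigma v_k<_\sigma\dots<_\sigma v_1$. -}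

module Defs where

open import Data.Nat using (ℕ; suc; _*_; _<_; _≤_)
open import Data.Nat.DivMod using (_/_)
open import Data.Fin using (Fin)
import Data.Fin as Fin
open import Data.List using (List; length)
open import Data.List.Membership.Propositional using (_∈_)
open import Data.List.Relation.Unary.Unique.Propositional using (Unique)
open import Data.Product using (_×_; Σ; ∃; ∃-syntax; proj₁)
open import Data.Sum using (_⊎_)
open import Relation.Binary.PropositionalEquality using (_≡_)
open import Relation.Nullary using (¬_)
open import Function.Definitions using (Injective)

record IsPoset {n : ℕ} (_<P_ : Fin n → Fin n → Set) : Set where
  field
    trans : ∀ {a b c} → a <P b → b <P c → a <P c
    asym  : ∀ {a b} → a <P b → ¬ (b <P a)

Order : ℕ → Set
Order n = Σ (Fin n → ℕ) (λ pos → Injective _≡_ _≡_ pos)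

_<[_]_ : {n : ℕ} → Fin n → Order n → Fin n → Set
a <[ L ] b = proj₁ L a < proj₁ L b

IsLinearExtension : {n : ℕ} → (Fin n → Fin n → Set) → Order n → Set
IsLinearExtension _<P_ L = ∀ a b → a <P b → a <[ L ] b

IsRealizer : {n : ℕ} → (Fin n → Fin n → Set) → Order n → Order n → Set
IsRealizer _<P_ L₁ L₂ =
  IsLinearExtension _<P_ L₁ × IsLinearExtension _<P_ L₂ ×
  (∀ a b → a <[ L₁ ] b → a <[ L₂ ] b → a <P b)

Incomparable : {n : ℕ} → (Fin n → Fin n → Set) → Fin n → Fin n → Set
Incomparable _<P_ a b = ¬ (a <P b) × ¬ (b <P a)

IsAntichain : {n : ℕ} → (Fin n → Fin n → Set) → List (Fin n) → Set
IsAntichain _<P_ A = Unique A × (∀ {a b} → a ∈ A → b ∈ A → ¬ (a ≡ b) → Incomparable _<P_ a b)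

HasWidth : {n : ℕ} → (Fin n → Fin n → Set) → ℕ → Set
HasWidth _<P_ w =
  (∃[ A ] (IsAntichain _<P_ A × length A ≡ w)) ×
  (∀ A → IsAntichain _<P_ A → length A ≤ w)

Covers : {n : ℕ} → (Fin n → Fin n → Set) → Fin n → Fin n → Set
Covers _<P_ a b = a <P b × (∀ c → ¬ (a <P c × c <P b))

CoverEdge : {n : ℕ} → (Fin n → Fin n → Set) → Fin n → Fin n → Set
CoverEdge _<P_ a b = Covers _<P_ a b ⊎ Covers _<P_ b a

HasRainbow : {n : ℕ} → (Fin n → Fin n → Set) → Order n → ℕ → Set
HasRainbow {n} _<P_ σ k =
  Σ (Fin k → Fin n) λ u → Σ (Fin k → Fin n) λ v →
    ((∀ (i : Fin k) → CoverEdge _<P_ (u i) (v i)) ×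
     (∀ (i j : Fin k) → i Fin.< j → u i <[ σ ] u j) ×
     (∀ (i j : Fin k) → i Fin.< j → v j <[ σ ] v i) ×
     (∀ (i j : Fin k) → u i <[ σ ] v j))

{-# OPTIONS --safe #-}
-- R_w is the dominance order of a permutation π_w of {0, …, w(w+1) − 1}: a < b iff a < b
-- and π_w a < π_w b, so the position order and π_w realize it. R_{m+1} is built from m + 1
-- new left elements, a copy of R_m and m + 1 new right elements, in this order; in L₂ the
-- copy of R_m lies above all new elements, the left ones get π-values 2m, 2m − 2, …, 0 and
-- the right ones 1, 3, …, 2m + 1. So the i-th left and the (m − i)-th right element have
-- consecutive π-values and form a cover edge enclosing all edges of R_m; the rainbow joins
-- positions i and w(w+1) − 1 − i for i < w(w+1)/2. The w outermost left elements form an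
-- antichain, and labelling the i-th left element of each layer by i and its right
-- elements by the last label of that layer partitions R_w into w chains.
module Submission where

open import Defs
open import Data.Nat using (ℕ; zero; suc; _*_; _≤_; _+_; _∸_; _<_; z≤n; s≤s; s≤s⁻¹; z<s)
open import Data.Nat.Properties
open import Data.Nat.DivMod using (_/_; m*n/n≡m)
open import Data.Nat.Tactic.RingSolver using (solve-∀)
open import Data.Fin as Fin using (Fin; toℕ; inject≤; opposite)
open import Data.Fin.Properties using (toℕ-injective; toℕ<n; toℕ-fromℕ<; toℕ-inject≤; opposite-prop; pigeonhole)
  renaming (<⇒≢ to <⇒≢ᶠ)
open import Data.List using (List; length; lookup; tabulate)
import Data.List.Relation.Unary.All as All
open import Data.List.Relation.Unary.AllPairs using (_∷_)
open import Data.List.Relation.Unary.Unique.Propositional using (Unique)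
open import Data.List.Relation.Unary.Unique.Propositional.Properties using (tabulate⁺)
open import Data.List.Membership.Propositional using (_∈_)
open import Data.List.Membership.Propositional.Properties using (∈-lookup; ∈-tabulate⁻)
open import Data.List.Properties using (length-tabulate)
open import Data.Product using (_×_; ∃-syntax; _,_; proj₁; proj₂)
open import Data.Sum using (_⊎_; inj₁; inj₂; [_,_]′)
open import Function using (_∘_)
open import Relation.Nullary using (¬_; yes; no; contradiction)
open import Relation.Binary using (tri<; tri≈; tri>)
open import Relation.Binary.PropositionalEquality

lookup-injective : ∀ {A : Set} {xs : List A} → Unique xs →
                   ∀ i j → lookup xs i ≡ lookup xs j → i ≡ j
lookup-injective (_ ∷ _) Fin.zero Fin.zero _ = refl
lookup-injective (x∉xs ∷ _) Fin.zero (Fin.suc j) eq = contradiction eq (All.lookup x∉xs (∈-lookup j))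
lookup-injective (x∉xs ∷ _) (Fin.suc i) Fin.zero eq = contradiction (sym eq) (All.lookup x∉xs (∈-lookup i))
lookup-injective (_ ∷ u) (Fin.suc i) (Fin.suc j) eq = cong Fin.suc (lookup-injective u i j eq)

module _ {n : ℕ} {_<P_ : Fin n → Fin n → Set} where

  antichain-tabulate : ∀ {w} (f : Fin w → Fin n) → (∀ {i j} → f i ≡ f j → i ≡ j) →
                       (∀ {i j} → i ≢ j → ¬ f i <P f j) → IsAntichain _<P_ (tabulate f)
  antichain-tabulate f f-injective unrelated = tabulate⁺ f-injective , incomparable
    where
    incomparable : ∀ {a b} → a ∈ tabulate f → b ∈ tabulate f → a ≢ b → Incomparable _<P_ a b
    incomparable a∈ b∈ a≢b with ∈-tabulate⁻ a∈ | ∈-tabulate⁻ b∈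
    ... | i , refl | j , refl = unrelated (a≢b ∘ cong f) , unrelated (a≢b ∘ cong f ∘ sym)

  antichain-length≤ : ∀ {w} (c : Fin n → Fin w) →
                      (∀ {a b} → a ≢ b → c a ≡ c b → a <P b ⊎ b <P a) →
                      ∀ A → IsAntichain _<P_ A → length A ≤ w
  antichain-length≤ {w} c same-chain-comparable A (unique , incomparable) with length A ≤? w
  ... | yes |A|≤w = |A|≤w
  ... | no |A|≰w with pigeonhole (≰⇒> |A|≰w) (c ∘ lookup A)
  ... | i , j , i<j , same-chain =
    contradiction (same-chain-comparable a≢b same-chain) [ proj₁ a∥b , proj₂ a∥b ]′
    where
    a≢b : lookup A i ≢ lookup A j
    a≢b = <⇒≢ᶠ i<j ∘ lookup-injective unique i j
    a∥b : Incomparable _<P_ (lookup A i) (lookup A j)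
    a∥b = incomparable (∈-lookup i) (∈-lookup j) a≢b

positionOrder : ∀ {n} → Order n
positionOrder = toℕ , toℕ-injective

module Dominance {n : ℕ} (f : ℕ → ℕ) where

  _≺_ : Fin n → Fin n → Set
  a ≺ b = toℕ a < toℕ b × f (toℕ a) < f (toℕ b)

  ≺-isPoset : IsPoset _≺_
  ≺-isPoset = record
    { trans = λ (a<b , fa<fb) (b<c , fb<fc) → <-trans a<b b<c , <-trans fa<fb fb<fc
    ; asym  = λ (a<b , _) (b<a , _) → <-asym a<b b<a
    }

  module _ (f-injective : ∀ {a b} → a < n → b < n → f a ≡ f b → a ≡ b) where

    valueOrder : Order n
    valueOrder = f ∘ toℕ , λ {a} {b} → toℕ-injective ∘ f-injective (toℕ<n a) (toℕ<n b)

    ≺-isRealizer : IsRealizer _≺_ positionOrder valueOrder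
    ≺-isRealizer = (λ _ _ → proj₁) , (λ _ _ → proj₂) , (λ _ _ → _,_)

  ≺-antichain : ∀ {w} → w ≤ n → (∀ {a b} → a < b → b < w → f b < f a) →
                ∃[ A ] (IsAntichain _≺_ A × length A ≡ w)
  ≺-antichain {w} w≤n f-decreasing =
    tabulate first , antichain-tabulate first first-injective unrelated , length-tabulate first
    where
    first : Fin w → Fin n
    first i = inject≤ i w≤n
    toℕ-first : ∀ i → toℕ (first i) ≡ toℕ i
    toℕ-first i = toℕ-inject≤ i w≤n
    first-injective : ∀ {i j} → first i ≡ first j → i ≡ j
    first-injective {i} {j} eq = toℕ-injective (trans (sym (toℕ-first i)) (trans (cong toℕ eq) (toℕ-first j)))
    unrelated : ∀ {i j} → i ≢ j → ¬ first i ≺ first j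
    unrelated {i} {j} _ (i<j , fi<fj) rewrite toℕ-first i | toℕ-first j =
      <-asym fi<fj (f-decreasing i<j (toℕ<n j))

  ≺-width≤ : ∀ {w} (c : ℕ → ℕ) → (∀ {a} → a < n → c a < w) →
             (∀ {a b} → a < b → b < n → c a ≡ c b → f a < f b) →
             ∀ A → IsAntichain _≺_ A → length A ≤ w
  ≺-width≤ {w} c c<w f-increasing-on-chains = antichain-length≤ chainOf comparable
    where
    chainOf : Fin n → Fin w
    chainOf a = Fin.fromℕ< (c<w (toℕ<n a))
    same-c : ∀ {a b} → chainOf a ≡ chainOf b → c (toℕ a) ≡ c (toℕ b)
    same-c eq = trans (sym (toℕ-fromℕ< _)) (trans (cong toℕ eq) (toℕ-fromℕ< _))
    comparable : ∀ {a b} → a ≢ b → chainOf a ≡ chainOf b → a ≺ b ⊎ b ≺ a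
    comparable {a} {b} a≢b eq with <-cmp (toℕ a) (toℕ b)
    ... | tri< a<b _ _ = inj₁ (a<b , f-increasing-on-chains a<b (toℕ<n b) (same-c eq))
    ... | tri≈ _ a≡b _ = contradiction (toℕ-injective a≡b) a≢b
    ... | tri> _ _ b<a = inj₂ (b<a , f-increasing-on-chains b<a (toℕ<n a) (sym (same-c eq)))

  ≺-covers : ∀ {a b} → toℕ a < toℕ b → f (toℕ b) ≡ suc (f (toℕ a)) → Covers _≺_ a b
  ≺-covers a<b fb≡1+fa = (a<b , subst (f _ <_) (sym fb≡1+fa) (n<1+n _)) ,
    λ _ ((_ , fa<fc) , (_ , fc<fb)) →
      <-irrefl refl (<-≤-trans fa<fc (s≤s⁻¹ (subst (f _ <_) fb≡1+fa fc<fb)))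

  ≺-rainbow : ∀ k → k + k ≤ n → (∀ i → i < k → f (n ∸ suc i) ≡ suc (f i)) →
              HasRainbow _≺_ positionOrder k
  ≺-rainbow k k+k≤n f-mirror =
    u , v ,
    (λ i → inj₁ (≺-covers (u<v i i) (f-mirror-uv i))) ,
    (λ i j i<j → subst₂ _<_ (sym (toℕ-u i)) (sym (toℕ-u j)) i<j) ,
    (λ i j i<j → subst₂ _<_ (sym (toℕ-v j)) (sym (toℕ-v i)) (∸-monoʳ-< (s≤s i<j) (1+i≤n j))) ,
    u<v
    where
    k≤n : k ≤ n
    k≤n = m+n≤o⇒m≤o k k+k≤n
    u v : Fin k → Fin n
    u i = inject≤ i k≤n
    v i = opposite (u i)
    toℕ-u : ∀ i → toℕ (u i) ≡ toℕ i
    toℕ-u i = toℕ-inject≤ i k≤n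
    toℕ-v : ∀ i → toℕ (v i) ≡ n ∸ suc (toℕ i)
    toℕ-v i = trans (opposite-prop (u i)) (cong (λ x → n ∸ suc x) (toℕ-u i))
    1+i≤n : ∀ (i : Fin k) → suc (toℕ i) ≤ n
    1+i≤n i = ≤-trans (toℕ<n i) k≤n
    u<v : ∀ i j → toℕ (u i) < toℕ (v j)
    u<v i j = subst₂ _<_ (sym (toℕ-u i)) (sym (toℕ-v j))
      (m+n≤o⇒m≤o∸n (suc (toℕ i)) (≤-trans (+-mono-≤ (toℕ<n i) (toℕ<n j)) k+k≤n))
    f-mirror-uv : ∀ i → f (toℕ (v i)) ≡ suc (f (toℕ (u i)))
    f-mirror-uv i rewrite toℕ-u i | toℕ-v i = f-mirror (toℕ i) (toℕ<n i)

_++⟨_⟩_ : {A : Set} → (ℕ → A) → ℕ → (ℕ → A) → ℕ → A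
(f ++⟨ n ⟩ g) e with e <? n
... | yes _ = f e
... | no _  = g (e ∸ n)

++⟨⟩-< : ∀ {A : Set} (f g : ℕ → A) {n e} → e < n → (f ++⟨ n ⟩ g) e ≡ f e
++⟨⟩-< f g {n} {e} e<n with e <? n
... | yes _   = refl
... | no e≮n = contradiction e<n e≮n

++⟨⟩-+ : ∀ {A : Set} (f g : ℕ → A) n j → (f ++⟨ n ⟩ g) (n + j) ≡ g j
++⟨⟩-+ f g n j with n + j <? n
... | yes n+j<n = contradiction n+j<n (m+n≮m n j)
... | no _      = cong g (m+n∸m≡n n j)

triangle : ℕ → ℕ
triangle zero    = 0
triangle (suc m) = suc m + triangle m

size : ℕ → ℕ
size zero    = 0
size (suc m) = suc m + (size m + suc m)

size≡triangle+triangle : ∀ w → size w ≡ triangle w + triangle w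
size≡triangle+triangle zero    = refl
size≡triangle+triangle (suc m) =
  trans (cong (λ t → suc m + (t + suc m)) (size≡triangle+triangle m)) (regroup (suc m) (triangle m))
  where
  regroup : ∀ a k → a + ((k + k) + a) ≡ (a + k) + (a + k)
  regroup = solve-∀

triangle≤size : ∀ w → triangle w ≤ size w
triangle≤size w = subst (triangle w ≤_) (sym (size≡triangle+triangle w)) (m≤m+n (triangle w) (triangle w))

w≤size : ∀ w → w ≤ size w
w≤size zero    = z≤n
w≤size (suc m) = m≤m+n (suc m) _

w*[1+w]/2≡triangle : ∀ w → (w * suc w) / 2 ≡ triangle w
w*[1+w]/2≡triangle w = trans (cong (_/ 2) (sym (triangle*2 w))) (m*n/n≡m (triangle w) 2)
  where
  triangle*2 : ∀ w → triangle w * 2 ≡ w * suc w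
  triangle*2 zero    = refl
  triangle*2 (suc m) = begin
    (suc m + triangle m) * 2     ≡⟨ *-distribʳ-+ 2 (suc m) (triangle m) ⟩
    suc m * 2 + triangle m * 2   ≡⟨ cong (suc m * 2 +_) (triangle*2 m) ⟩
    suc m * 2 + m * suc m        ≡⟨ regroup m ⟩
    suc m * suc (suc m)          ∎
    where
    open ≡-Reasoning
    regroup : ∀ m → suc m * 2 + m * suc m ≡ suc m * suc (suc m)
    regroup = solve-∀

π : ℕ → ℕ → ℕ
π zero    = λ _ → 0
π (suc m) = (λ i → 2 * (m ∸ i)) ++⟨ suc m ⟩ ((λ j → 2 * suc m + π m j) ++⟨ size m ⟩ (λ j → suc (2 * j)))

chain : ℕ → ℕ → ℕ
chain zero    = λ _ → 0
chain (suc m) = (λ i → i) ++⟨ suc m ⟩ (chain m ++⟨ size m ⟩ λ _ → m)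

data Block (m : ℕ) : ℕ → Set where
  left  : ∀ {i} → i < suc m → Block m i
  inner : ∀ {j} → j < size m → Block m (suc m + j)
  right : ∀ j → Block m (suc m + (size m + j))

block : ∀ m e → Block m e
block m e with e <? suc m
... | yes e<1+m = left e<1+m
... | no e≮1+m with m≤n⇒∃[o]m+o≡n (≮⇒≥ e≮1+m)
... | d , refl with d <? size m
... | yes d<size = inner d<size
... | no d≮size with m≤n⇒∃[o]m+o≡n (≮⇒≥ d≮size)
... | j , refl = right j

module _ (m : ℕ) where

  right-bound : ∀ {j} → suc m + (size m + j) < size (suc m) → j < suc m
  right-bound {j} = +-cancelˡ-< (size m) j (suc m) ∘ +-cancelˡ-< (suc m) (size m + j) (size m + suc m)

  left≯shifted : ∀ {i j} → i < suc m → ¬ suc m + j < i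
  left≯shifted i<1+m a<i = m+n≮m (suc m) _ (<-trans a<i i<1+m)

  inner≯right : ∀ {i j} → i < size m → ¬ suc m + (size m + j) < suc m + i
  inner≯right i<size a<b = m+n≮m (size m) _ (<-trans (+-cancelˡ-< (suc m) _ _ a<b) i<size)

  π-left : ∀ {i} → i < suc m → π (suc m) i ≡ 2 * (m ∸ i)
  π-left = ++⟨⟩-< _ _

  π-inner : ∀ {j} → j < size m → π (suc m) (suc m + j) ≡ 2 * suc m + π m j
  π-inner {j} j<size = trans (++⟨⟩-+ _ _ (suc m) j) (++⟨⟩-< _ _ j<size)

  π-right : ∀ j → π (suc m) (suc m + (size m + j)) ≡ suc (2 * j)
  π-right j = trans (++⟨⟩-+ _ _ (suc m) (size m + j)) (++⟨⟩-+ _ _ (size m) j)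

  chain-left : ∀ {i} → i < suc m → chain (suc m) i ≡ i
  chain-left = ++⟨⟩-< _ _

  chain-inner : ∀ {j} → j < size m → chain (suc m) (suc m + j) ≡ chain m j
  chain-inner {j} j<size = trans (++⟨⟩-+ _ _ (suc m) j) (++⟨⟩-< _ _ j<size)

  chain-right : ∀ j → chain (suc m) (suc m + (size m + j)) ≡ m
  chain-right j = trans (++⟨⟩-+ _ _ (suc m) (size m + j)) (++⟨⟩-+ _ _ (size m) j)

  π-left-< : ∀ {i} → i < suc m → π (suc m) i < 2 * suc m
  π-left-< {i} i<1+m = subst (_< 2 * suc m) (sym (π-left i<1+m)) (*-monoʳ-< 2 (s≤s (m∸n≤m m i)))

  π-right-< : ∀ {j} → j < suc m → π (suc m) (suc m + (size m + j)) < 2 * suc m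
  π-right-< {j} (s≤s j≤m) = subst₂ _<_ (sym (π-right j)) (sym (*-suc 2 m)) (s≤s (s≤s (*-monoʳ-≤ 2 j≤m)))

  π-inner-≥ : ∀ {j} → j < size m → 2 * suc m ≤ π (suc m) (suc m + j)
  π-inner-≥ j<size = subst (2 * suc m ≤_) (sym (π-inner j<size)) (m≤m+n _ _)

π-decreasing-on-first : ∀ w {a b} → a < b → b < w → π w b < π w a
π-decreasing-on-first (suc m) {a} {b} a<b b<1+m = begin-strict
  π (suc m) b   ≡⟨ π-left m b<1+m ⟩
  2 * (m ∸ b)   <⟨ *-monoʳ-< 2 (∸-monoʳ-< a<b (s≤s⁻¹ b<1+m)) ⟩
  2 * (m ∸ a)   ≡⟨ π-left m (<-trans a<b b<1+m) ⟨
  π (suc m) a   ∎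
  where open ≤-Reasoning

chain<w : ∀ w {e} → e < size w → chain w e < w
chain<w (suc m) {e} e<size with block m e
... | left e<1+m    = subst (_< suc m) (sym (chain-left m e<1+m)) e<1+m
... | inner j<size  = subst (_< suc m) (sym (chain-inner m j<size)) (m<n⇒m<1+n (chain<w m j<size))
... | right j       = subst (_< suc m) (sym (chain-right m j)) (n<1+n m)

π-≢ : ∀ w {a b} → a < b → b < size w → π w a ≢ π w b
π-≢ (suc m) {a} {b} a<b b<size with block m a | block m b
... | left _       | left b<1+m  = >⇒≢ (π-decreasing-on-first (suc m) a<b b<1+m)
... | left a<1+m   | inner b<size′ = <⇒≢ (<-≤-trans (π-left-< m a<1+m) (π-inner-≥ m b<size′))
... | left a<1+m   | right j     rewrite π-left m a<1+m | π-right m j = even≢odd (m ∸ a) j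
... | inner _      | left b<1+m  = contradiction a<b (left≯shifted m b<1+m)
... | inner a<size′ | inner b<size′ = λ πa≡πb →
  π-≢ m (+-cancelˡ-< (suc m) _ _ a<b) b<size′
    (+-cancelˡ-≡ (2 * suc m) _ _ (trans (sym (π-inner m a<size′)) (trans πa≡πb (π-inner m b<size′))))
... | inner a<size′ | right _    = >⇒≢ (<-≤-trans (π-right-< m (right-bound m b<size)) (π-inner-≥ m a<size′))
... | right _      | left b<1+m  = contradiction a<b (left≯shifted m b<1+m)
... | right _      | inner b<size′ = contradiction a<b (inner≯right m b<size′)
... | right j      | right j′    rewrite π-right m j | π-right m j′ =
  <⇒≢ (s≤s (*-monoʳ-< 2 (+-cancelˡ-< (size m) j j′ (+-cancelˡ-< (suc m) _ _ a<b))))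

π-injective : ∀ w {a b} → a < size w → b < size w → π w a ≡ π w b → a ≡ b
π-injective w {a} {b} a<size b<size πa≡πb with <-cmp a b
... | tri< a<b _ _ = contradiction πa≡πb (π-≢ w a<b b<size)
... | tri≈ _ a≡b _ = a≡b
... | tri> _ _ b<a = contradiction (sym πa≡πb) (π-≢ w b<a a<size)

π-increasing-on-chains : ∀ w {a b} → a < b → b < size w → chain w a ≡ chain w b → π w a < π w b
π-increasing-on-chains (suc m) {a} {b} a<b b<size same with block m a | block m b
... | left a<1+m   | left b<1+m  =
  contradiction (trans (sym (chain-left m a<1+m)) (trans same (chain-left m b<1+m))) (<⇒≢ a<b)
... | left a<1+m   | inner b<size′ = <-≤-trans (π-left-< m a<1+m) (π-inner-≥ m b<size′)
... | left a<1+m   | right j     = begin-strict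
  π (suc m) a                         ≡⟨ π-left m a<1+m ⟩
  2 * (m ∸ a)                         ≡⟨ cong (λ x → 2 * (m ∸ x)) a≡m ⟩
  2 * (m ∸ m)                         ≡⟨ cong (2 *_) (n∸n≡0 m) ⟩
  0                                   <⟨ z<s ⟩
  suc (2 * j)                         ≡⟨ π-right m j ⟨
  π (suc m) (suc m + (size m + j))    ∎
  where
  open ≤-Reasoning
  a≡m : a ≡ m
  a≡m = trans (sym (chain-left m a<1+m)) (trans same (chain-right m j))
... | inner _      | left b<1+m  = contradiction a<b (left≯shifted m b<1+m)
... | inner a<size′ | inner b<size′ =
  subst₂ _<_ (sym (π-inner m a<size′)) (sym (π-inner m b<size′))
    (+-monoʳ-< (2 * suc m) (π-increasing-on-chains m (+-cancelˡ-< (suc m) _ _ a<b) b<size′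
      (trans (sym (chain-inner m a<size′)) (trans same (chain-inner m b<size′)))))
... | inner a<size′ | right j    =
  contradiction (trans (sym (chain-inner m a<size′)) (trans same (chain-right m j))) (<⇒≢ (chain<w m a<size′))
... | right _      | left b<1+m  = contradiction a<b (left≯shifted m b<1+m)
... | right _      | inner b<size′ = contradiction a<b (inner≯right m b<size′)
... | right j      | right j′    = subst₂ _<_ (sym (π-right m j)) (sym (π-right m j′))
  (s≤s (*-monoʳ-< 2 (+-cancelˡ-< (size m) j j′ (+-cancelˡ-< (suc m) _ _ a<b))))

π-mirror : ∀ w i → i < triangle w → π w (size w ∸ suc i) ≡ suc (π w i)
π-mirror (suc m) i i<triangle with block m i
... | left i<1+m = begin
  π (suc m) (size (suc m) ∸ suc i)         ≡⟨ cong (π (suc m)) mirror ⟩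
  π (suc m) (suc m + (size m + (m ∸ i)))   ≡⟨ π-right m (m ∸ i) ⟩
  suc (2 * (m ∸ i))                        ≡⟨ cong suc (π-left m i<1+m) ⟨
  suc (π (suc m) i)                        ∎
  where
  open ≡-Reasoning
  mirror : size (suc m) ∸ suc i ≡ suc m + (size m + (m ∸ i))
  mirror = begin
    suc m + (size m + suc m) ∸ suc i     ≡⟨ +-∸-assoc (suc m) (≤-trans i<1+m (m≤n+m (suc m) (size m))) ⟩
    suc m + ((size m + suc m) ∸ suc i)   ≡⟨ cong (suc m +_) (+-∸-assoc (size m) i<1+m) ⟩
    suc m + (size m + (m ∸ i))           ∎
... | inner {j} j<size = begin
  π (suc m) (size (suc m) ∸ suc (suc m + j))   ≡⟨ cong (π (suc m)) mirror ⟩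
  π (suc m) (suc m + (size m ∸ suc j))         ≡⟨ π-inner m (∸-monoʳ-< z<s j<size) ⟩
  2 * suc m + π m (size m ∸ suc j)             ≡⟨ cong (2 * suc m +_) (π-mirror m j j<triangle) ⟩
  2 * suc m + suc (π m j)                      ≡⟨ +-suc (2 * suc m) (π m j) ⟩
  suc (2 * suc m + π m j)                      ≡⟨ cong suc (π-inner m j<size) ⟨
  suc (π (suc m) (suc m + j))                  ∎
  where
  open ≡-Reasoning
  j<triangle : j < triangle m
  j<triangle = +-cancelˡ-< (suc m) j (triangle m) i<triangle
  mirror : size (suc m) ∸ suc (suc m + j) ≡ suc m + (size m ∸ suc j)
  mirror = begin
    size (suc m) ∸ suc (suc m + j)               ≡⟨ cong (size (suc m) ∸_) (+-suc (suc m) j) ⟨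
    suc m + (size m + suc m) ∸ (suc m + suc j)   ≡⟨ [m+n]∸[m+o]≡n∸o (suc m) (size m + suc m) (suc j) ⟩
    (size m + suc m) ∸ suc j                     ≡⟨ +-∸-comm (suc m) j<size ⟩
    (size m ∸ suc j) + suc m                     ≡⟨ +-comm (size m ∸ suc j) (suc m) ⟩
    suc m + (size m ∸ suc j)                     ∎
... | right j = contradiction (≤-trans (triangle≤size m) (m≤m+n (size m) j))
                              (<⇒≱ (+-cancelˡ-< (suc m) _ _ i<triangle))

lemma1 : (w : ℕ) → 1 ≤ w →
    ∃[ n ] ∃[ R ] (IsPoset {n} R × HasWidth R w ×
      ∃[ L₁ ] ∃[ L₂ ] (IsRealizer R L₁ L₂ × HasRainbow R L₁ ((w * suc w) / 2)))
lemma1 w _ =  -- the construction works for w = 0 as well (R₀ is empty)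
  size w , _≺_ , ≺-isPoset ,
  (≺-antichain (w≤size w) (π-decreasing-on-first w) ,
   ≺-width≤ (chain w) (chain<w w) (π-increasing-on-chains w)) ,
  positionOrder , valueOrder (π-injective w) , ≺-isRealizer (π-injective w) ,
  subst (HasRainbow _≺_ positionOrder) (sym (w*[1+w]/2≡triangle w))
    (≺-rainbow (triangle w) (≤-reflexive (sym (size≡triangle+triangle w))) (π-mirror w))
  where open Dominance (π w)
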